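{- For integers $0\le d\le n$ define $$g_{n,d}(t)=\sum_{i=1}^{\min(d,n-d)} \frac{(n-i-1)!}{(d-i)!\,(n-d-i)!\,(i-1)!}\, t^i$$ (empty sum $=0$; so $g_{n,0}(t)=0$, $g_{n,1}(t)=t$, $g_{n,2}(t)=(n-2)t+(n-3)t^2$ for $n\ge 3$), and let $c_d(n)=n+1-2d$. Then for $n\ge 3$ and $2\le d\le \lfloor n/2\rfloor+1$, $$g_{n,d}(t)=\frac{c_d(n+1)\big(c_d(n)c_d(n+2)t+(n-d)^2+(d-2)^2+n-2\big)}{(d-1)(n-d)c_d(n+2)}\, g_{n,d-1}(t)-\frac{(d-2)(n+1-d)c_d(n)}{(d-1)(n-d)c_d(n+2)}\, g_{n,d-2}(t),$$ and for $n\ge 3$ and $2\le d\le n-1$, $$g_{n,d}(t)=\frac{(n+1-2d)(n+1-d)t+(n-d)^2+n-2d+1}{(d-1)(n-d)}\, g_{n,d-1}(t)-\frac{t(t+1)(n+1-2d)}{(d-1)(n-d)}\, g_{n,d-1}'(t).$$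
   Context: $g_{n,d}$ is Speyer's $g$-polynomial of the uniform matroid $U_{n,d}$; $g'$ denotes the derivative in $t$. -}

module Defs where

open import Data.Nat as ℕ using (ℕ; zero; suc; _∸_; _⊓_; _≤?_; _!)
open import Data.Integer as ℤ using (ℤ; +_)
open import Data.Rational as ℚ using (ℚ; 0ℚ; 1ℚ; _/_; _+_; _-_; _*_; 1/_)
open import Data.Rational.Properties using (_≟_)
open import Relation.Nullary using (yes; no)
open import Relation.Binary.PropositionalEquality using (_≢_)

ℕ→ℚ : ℕ → ℚ
ℕ→ℚ m = + m / 1

ℤ→ℚ : ℤ → ℚ
ℤ→ℚ z = z / 1

-- Total division on ℚ (x ÷ 0 := 0); only ever used with nonzero denominators.
_÷_ : ℚ → ℚ → ℚ
p ÷ q with q ≟ 0ℚ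
... | yes _ = 0ℚ
... | no q≢0 = p * (1/_ q {{ℚ.≢-nonZero q≢0}})

infixl 7 _÷_

-- Polynomials in t over ℚ, as coefficient sequences (coefficient of t^k).
Poly : Set
Poly = ℕ → ℚ

const : ℚ → Poly
const a zero = a
const a (suc k) = 0ℚ

T : Poly
T (suc zero) = 1ℚ
T _ = 0ℚ

_⊕_ : Poly → Poly → Poly
(p ⊕ q) k = p k + q k

_⊖_ : Poly → Poly → Poly
(p ⊖ q) k = p k - q k

sumTo : ℕ → (ℕ → ℚ) → ℚ
sumTo zero f = f zero
sumTo (suc k) f = sumTo k f + f (suc k)

_⊗_ : Poly → Poly → Poly
(p ⊗ q) k = sumTo k (λ i → p i * q (k ∸ i))

infixl 6 _⊕_ _⊖_
infixl 7 _⊗_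

deriv : Poly → Poly
deriv p k = ℕ→ℚ (suc k) * p (suc k)

g : ℕ → ℕ → Poly
g n d zero = 0ℚ
g n d (suc j) with suc j ≤? d ⊓ (n ∸ d)
... | yes _ = ℕ→ℚ ((n ∸ suc j ∸ 1) !)
              ÷ ℕ→ℚ (((d ∸ suc j) !) ℕ.* ((n ∸ d ∸ suc j) !) ℕ.* (j !))
... | no _ = 0ℚ

c : ℕ → ℕ → ℚ
c d m = ℤ→ℚ (+ (m ℕ.+ 1) ℤ.- + (2 ℕ.* d))

{-# OPTIONS --safe #-}
module Submission where

-- For 1 ≤ i ≤ min(d, n − d) the coefficient of t^i in g n d is the multinomial coefficient
-- (a + b + c)! / (a! b! c!) with a = d − i, b = n − d − i, c = i − 1; for other i it is 0.
-- Compare both recurrences at t^(r+1).  Either that index lies outside the support of every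
-- polynomial involved, or d = x + r + 1 and n = x + y + 2r with x + y + r = s + 2; then the
-- four coefficients involved, multiplied by x! y! r! / s!, are y(y−1), xy, r(x+y+r−1) and
-- x(x−1), and each recurrence becomes a polynomial identity in x, y and r.

open import Defs
open import Data.Empty using (⊥-elim)
import Data.Integer.Base as ℤ
import Data.Integer.Properties as ℤ
open import Data.Nat.Base as ℕ using (ℕ; zero; suc; _∸_; _⊓_; _!; _≤_; _<_; s≤s; z≤n; _/_; NonZero)
import Data.Nat.Properties as ℕ
open import Data.Nat.Properties using (_≤?_; _!≢0; _!*_!≢0)
open import Data.Nat.DivMod using (m/n*n≤m)
import Data.Nat.Coprimality as Coprimality
open import Data.Nat.Tactic.RingSolver using (solve-∀)
open import Data.Product.Base using (_×_; _,_)
open import Data.Rational.Base as ℚ using (ℚ; mkℚ; 0ℚ; 1ℚ; _+_; _-_; _*_; -_)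
open import Data.Rational.Properties
  using (_≟_; normalize-coprime; +-*-commutativeRing; +-identityˡ; +-identityʳ; +-assoc;
         *-zeroˡ; *-zeroʳ; *-identityˡ; *-identityʳ; *-inverseˡ; *-assoc; *-comm)
open import Data.Sum.Base using (_⊎_; inj₁; inj₂; [_,_]′)
open import Level using (0ℓ)
open import Relation.Binary.PropositionalEquality
open import Relation.Nullary using (yes; no; ¬_)
open import Relation.Nullary.Decidable.Core using (dec⇒maybe)
import Tactic.RingSolver.Core.AlmostCommutativeRing as ACR
import Tactic.RingSolver as RingSolver
open ≡-Reasoning

ℚ-ring : ACR.AlmostCommutativeRing 0ℓ 0ℓ
ℚ-ring = ACR.fromCommutativeRing +-*-commutativeRing (λ q → dec⇒maybe (0ℚ ≟ q))

ℕ→ℚ≡mkℚ : ∀ m → ℕ→ℚ m ≡ mkℚ (ℤ.+ m) 0 (Coprimality.sym (Coprimality.1-coprimeTo m))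
ℕ→ℚ≡mkℚ m = normalize-coprime (Coprimality.sym (Coprimality.1-coprimeTo m))

ℕ→ℚ-≢0 : ∀ m .{{_ : NonZero m}} → ℕ→ℚ m ≢ 0ℚ
ℕ→ℚ-≢0 (suc m) eq with trans (sym (ℕ→ℚ≡mkℚ (suc m))) eq
... | ()

ℕ→ℚ-suc : ∀ m → ℕ→ℚ (suc m) ≡ 1ℚ + ℕ→ℚ m
ℕ→ℚ-suc m rewrite ℕ→ℚ≡mkℚ m | ℤ.*-identityʳ (ℤ.+ m) = refl

ℕ→ℚ-+ : ∀ m n → ℕ→ℚ (m ℕ.+ n) ≡ ℕ→ℚ m + ℕ→ℚ n
ℕ→ℚ-+ zero    n = sym (+-identityˡ (ℕ→ℚ n))
ℕ→ℚ-+ (suc m) n = begin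
  ℕ→ℚ (suc (m ℕ.+ n))    ≡⟨ ℕ→ℚ-suc (m ℕ.+ n) ⟩
  1ℚ + ℕ→ℚ (m ℕ.+ n)     ≡⟨ cong (1ℚ +_) (ℕ→ℚ-+ m n) ⟩
  1ℚ + (ℕ→ℚ m + ℕ→ℚ n)   ≡⟨ +-assoc 1ℚ (ℕ→ℚ m) (ℕ→ℚ n) ⟨
  1ℚ + ℕ→ℚ m + ℕ→ℚ n     ≡⟨ cong (_+ ℕ→ℚ n) (ℕ→ℚ-suc m) ⟨
  ℕ→ℚ (suc m) + ℕ→ℚ n    ∎

ℕ→ℚ-+₃ : ∀ l m n → ℕ→ℚ (l ℕ.+ m ℕ.+ n) ≡ ℕ→ℚ l + ℕ→ℚ m + ℕ→ℚ n
ℕ→ℚ-+₃ l m n = trans (ℕ→ℚ-+ (l ℕ.+ m) n) (cong (_+ ℕ→ℚ n) (ℕ→ℚ-+ l m))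

ℕ→ℚ-* : ∀ m n → ℕ→ℚ (m ℕ.* n) ≡ ℕ→ℚ m * ℕ→ℚ n
ℕ→ℚ-* zero    n = sym (*-zeroˡ (ℕ→ℚ n))
ℕ→ℚ-* (suc m) n = begin
  ℕ→ℚ (n ℕ.+ m ℕ.* n)      ≡⟨ ℕ→ℚ-+ n (m ℕ.* n) ⟩
  ℕ→ℚ n + ℕ→ℚ (m ℕ.* n)    ≡⟨ cong (ℕ→ℚ n +_) (ℕ→ℚ-* m n) ⟩
  ℕ→ℚ n + ℕ→ℚ m * ℕ→ℚ n    ≡⟨ b+ab≡[1+a]b (ℕ→ℚ m) (ℕ→ℚ n) ⟩
  (1ℚ + ℕ→ℚ m) * ℕ→ℚ n     ≡⟨ cong (_* ℕ→ℚ n) (ℕ→ℚ-suc m) ⟨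
  ℕ→ℚ (suc m) * ℕ→ℚ n      ∎
  where
  b+ab≡[1+a]b : ∀ a b → b + a * b ≡ (1ℚ + a) * b
  b+ab≡[1+a]b = RingSolver.solve-∀ ℚ-ring

ℕ→ℚ-∸ : ∀ {m n} → n ≤ m → ℕ→ℚ (m ∸ n) ≡ ℕ→ℚ m - ℕ→ℚ n
ℕ→ℚ-∸ {m} {n} n≤m = begin
  ℕ→ℚ (m ∸ n)                     ≡⟨ a≡b+a-b (ℕ→ℚ (m ∸ n)) (ℕ→ℚ n) ⟩
  ℕ→ℚ n + ℕ→ℚ (m ∸ n) - ℕ→ℚ n     ≡⟨ cong (_- ℕ→ℚ n) (ℕ→ℚ-+ n (m ∸ n)) ⟨
  ℕ→ℚ (n ℕ.+ (m ∸ n)) - ℕ→ℚ n     ≡⟨ cong (λ k → ℕ→ℚ k - ℕ→ℚ n) (ℕ.m+[n∸m]≡n n≤m) ⟩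
  ℕ→ℚ m - ℕ→ℚ n                   ∎
  where
  a≡b+a-b : ∀ a b → a ≡ b + a - b
  a≡b+a-b = RingSolver.solve-∀ ℚ-ring

ℕ→ℚ-pred : ∀ m → ℕ→ℚ (suc m) - 1ℚ ≡ ℕ→ℚ m
ℕ→ℚ-pred m = sym (ℕ→ℚ-∸ {suc m} {1} (s≤s z≤n))

ℕ→ℚ[1+m]*m : ∀ m → ℕ→ℚ (suc m ℕ.* m) ≡ ℕ→ℚ (suc m) * (ℕ→ℚ (suc m) - 1ℚ)
ℕ→ℚ[1+m]*m m = trans (ℕ→ℚ-* (suc m) m) (cong (ℕ→ℚ (suc m) *_) (sym (ℕ→ℚ-pred m)))

ℕ→ℚ[m∸n]≢0 : ∀ {m n} → n < m → ℕ→ℚ (m ∸ n) ≢ 0ℚ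
ℕ→ℚ[m∸n]≢0 {m} {n} n<m = ℕ→ℚ-≢0 (m ∸ n) {{ℕ.≢-nonZero (ℕ.m>n⇒m∸n≢0 n<m)}}

ℕ→ℚ[x!y!z!]≢0 : ∀ x y z → ℕ→ℚ (x ! ℕ.* y ! ℕ.* z !) ≢ 0ℚ
ℕ→ℚ[x!y!z!]≢0 x y z =
  ℕ→ℚ-≢0 (x ! ℕ.* y ! ℕ.* z !) {{ℕ.m*n≢0 (x ! ℕ.* y !) (z !) {{x !* y !≢0}} {{z !≢0}}}}

ℤ→ℚ[+m-+n] : ∀ m n → ℤ→ℚ (ℤ.+ m ℤ.- ℤ.+ n) ≡ ℕ→ℚ m - ℕ→ℚ n
ℤ→ℚ[+m-+n] m n with ℕ.≤-total n m
... | inj₁ n≤m = begin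
  ℤ→ℚ (ℤ.+ m ℤ.- ℤ.+ n)   ≡⟨ cong ℤ→ℚ (trans (ℤ.m-n≡m⊖n m n) (ℤ.⊖-≥ n≤m)) ⟩
  ℕ→ℚ (m ∸ n)             ≡⟨ ℕ→ℚ-∸ n≤m ⟩
  ℕ→ℚ m - ℕ→ℚ n           ∎
... | inj₂ m≤n = begin
  ℤ→ℚ (ℤ.+ m ℤ.- ℤ.+ n)     ≡⟨ cong ℤ→ℚ (trans (ℤ.m-n≡m⊖n m n) (ℤ.⊖-≤ m≤n)) ⟩
  ℤ→ℚ (ℤ.- ℤ.+ (n ∸ m))     ≡⟨ ℤ→ℚ[-k] (n ∸ m) ⟩
  - ℕ→ℚ (n ∸ m)             ≡⟨ cong -_ (ℕ→ℚ-∸ m≤n) ⟩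
  - (ℕ→ℚ n - ℕ→ℚ m)         ≡⟨ -[a-b]≡b-a (ℕ→ℚ n) (ℕ→ℚ m) ⟩
  ℕ→ℚ m - ℕ→ℚ n             ∎
  where
  ℤ→ℚ[-k] : ∀ k → ℤ→ℚ (ℤ.- ℤ.+ k) ≡ - ℕ→ℚ k
  ℤ→ℚ[-k] zero    = refl
  ℤ→ℚ[-k] (suc k) = refl
  -[a-b]≡b-a : ∀ a b → - (a - b) ≡ b - a
  -[a-b]≡b-a = RingSolver.solve-∀ ℚ-ring

c-≡ : ∀ d m → c d m ≡ ℕ→ℚ m + 1ℚ - ℕ→ℚ 2 * ℕ→ℚ d
c-≡ d m = trans (ℤ→ℚ[+m-+n] (m ℕ.+ 1) (2 ℕ.* d)) (cong₂ _-_ (ℕ→ℚ-+ m 1) (ℕ→ℚ-* 2 d))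

c-≡+ : ∀ d m k → c d (m ℕ.+ k) ≡ ℕ→ℚ m + ℕ→ℚ k + 1ℚ - ℕ→ℚ 2 * ℕ→ℚ d
c-≡+ d m k = trans (c-≡ d (m ℕ.+ k)) (cong (λ M → M + 1ℚ - ℕ→ℚ 2 * ℕ→ℚ d) (ℕ→ℚ-+ m k))

c-≢0 : ∀ d m → 2 ℕ.* d ≤ m → c d m ≢ 0ℚ
c-≢0 d m 2d≤m = subst (_≢ 0ℚ) (sym c≡ℕ→ℚ) (ℕ→ℚ[m∸n]≢0 2d<m+1)
  where
  2d<m+1 : 2 ℕ.* d < m ℕ.+ 1
  2d<m+1 = ℕ.≤-trans (s≤s 2d≤m) (ℕ.≤-reflexive (ℕ.+-comm 1 m))
  c≡ℕ→ℚ : c d m ≡ ℕ→ℚ (m ℕ.+ 1 ∸ 2 ℕ.* d)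
  c≡ℕ→ℚ = cong ℤ→ℚ (trans (ℤ.m-n≡m⊖n (m ℕ.+ 1) (2 ℕ.* d)) (ℤ.⊖-≥ (ℕ.<⇒≤ 2d<m+1)))

p÷q≡p*[1÷q] : ∀ p q → p ÷ q ≡ p * (1ℚ ÷ q)
p÷q≡p*[1÷q] p q with q ≟ 0ℚ
... | yes _ = sym (*-zeroʳ p)
... | no  q≢0 = cong (p *_) (sym (*-identityˡ (ℚ.1/ q)))
  where
  instance
    q-nonZero : ℚ.NonZero q
    q-nonZero = ℚ.≢-nonZero q≢0

÷-*-cancel : ∀ p {q} → q ≢ 0ℚ → (p ÷ q) * q ≡ p
÷-*-cancel p {q} q≢0 with q ≟ 0ℚ
... | yes q≡0 = ⊥-elim (q≢0 q≡0)
... | no  _   = begin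
  p * ℚ.1/ q * q      ≡⟨ *-assoc p (ℚ.1/ q) q ⟩
  p * (ℚ.1/ q * q)    ≡⟨ cong (p *_) (*-inverseˡ q) ⟩
  p * 1ℚ              ≡⟨ *-identityʳ p ⟩
  p                   ∎
  where
  instance
    q-nonZero : ℚ.NonZero q
    q-nonZero = ℚ.≢-nonZero q≢0

a*D≡b⇒a≡b*[1÷D] : ∀ {D} → D ≢ 0ℚ → ∀ a {b} → a * D ≡ b → a ≡ b * (1ℚ ÷ D)
a*D≡b⇒a≡b*[1÷D] {D} D≢0 a {b} aD≡b = begin
  a                    ≡⟨ *-identityʳ a ⟨
  a * 1ℚ               ≡⟨ cong (a *_) (trans (*-comm D (1ℚ ÷ D)) (÷-*-cancel 1ℚ D≢0)) ⟨
  a * (D * (1ℚ ÷ D))   ≡⟨ *-assoc a D (1ℚ ÷ D) ⟨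
  a * D * (1ℚ ÷ D)     ≡⟨ cong (_* (1ℚ ÷ D)) aD≡b ⟩
  b * (1ℚ ÷ D)         ∎

*-≢0 : ∀ {p q} → p ≢ 0ℚ → q ≢ 0ℚ → p * q ≢ 0ℚ
*-≢0 {p} {q} p≢0 q≢0 pq≡0 =
  p≢0 (trans (a*D≡b⇒a≡b*[1÷D] q≢0 p refl) (trans (cong (_* (1ℚ ÷ q)) pq≡0) (*-zeroˡ (1ℚ ÷ q))))

v*Δ≡P*F⇒v≡P*[F÷Δ] : ∀ {Δ} → Δ ≢ 0ℚ → ∀ v P F → v * Δ ≡ P * F → v ≡ P * (F ÷ Δ)
v*Δ≡P*F⇒v≡P*[F÷Δ] {Δ} Δ≢0 v P F vΔ≡PF = begin
  v                    ≡⟨ a*D≡b⇒a≡b*[1÷D] Δ≢0 v vΔ≡PF ⟩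
  P * F * (1ℚ ÷ Δ)     ≡⟨ *-assoc P F (1ℚ ÷ Δ) ⟩
  P * (F * (1ℚ ÷ Δ))   ≡⟨ cong (P *_) (p÷q≡p*[1÷q] F Δ) ⟨
  P * (F ÷ Δ)          ∎

clear-denominator₁ : ∀ {D} → D ≢ 0ℚ → ∀ a p q e u v w →
  a * D ≡ p * u + q * v - e * w →
  a ≡ (p ÷ D) * u + (q ÷ D) * v - (e ÷ D) * w
clear-denominator₁ {D} D≢0 a p q e u v w eq
  rewrite p÷q≡p*[1÷q] p D | p÷q≡p*[1÷q] q D | p÷q≡p*[1÷q] e D =
  trans (a*D≡b⇒a≡b*[1÷D] D≢0 a eq) (distrib p q e u v w (1ℚ ÷ D))
  where
  distrib : ∀ p q e u v w i → (p * u + q * v - e * w) * i ≡ p * i * u + q * i * v - e * i * w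
  distrib = RingSolver.solve-∀ ℚ-ring

clear-denominator₂ : ∀ {D} → D ≢ 0ℚ → ∀ a p q e s t u v →
  a * D ≡ p * u + q * v - (e * (s * u) + e * (t * v)) →
  a ≡ (p ÷ D) * u + (q ÷ D) * v - ((e ÷ D) * (s * u) + (e ÷ D) * (t * v))
clear-denominator₂ {D} D≢0 a p q e s t u v eq
  rewrite p÷q≡p*[1÷q] p D | p÷q≡p*[1÷q] q D | p÷q≡p*[1÷q] e D =
  trans (a*D≡b⇒a≡b*[1÷D] D≢0 a eq) (distrib p q e s t u v (1ℚ ÷ D))
  where
  distrib : ∀ p q e s t u v i →
    (p * u + q * v - (e * (s * u) + e * (t * v))) * i
    ≡ p * i * u + q * i * v - (e * i * (s * u) + e * i * (t * v))
  distrib = RingSolver.solve-∀ ℚ-ring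

sumTo-suc : ∀ k f → sumTo (suc k) f ≡ f 0 + sumTo k (λ i → f (suc i))
sumTo-suc zero    f = refl
sumTo-suc (suc k) f = begin
  sumTo (suc k) f + f (2 ℕ.+ k)                     ≡⟨ cong (_+ f (2 ℕ.+ k)) (sumTo-suc k f) ⟩
  f 0 + sumTo k (λ i → f (suc i)) + f (2 ℕ.+ k)     ≡⟨ +-assoc (f 0) (sumTo k (λ i → f (suc i))) (f (2 ℕ.+ k)) ⟩
  f 0 + (sumTo k (λ i → f (suc i)) + f (2 ℕ.+ k))   ∎

sumTo-zero : ∀ k f → (∀ i → f i ≡ 0ℚ) → sumTo k f ≡ 0ℚ
sumTo-zero zero    f f≡0 = f≡0 0
sumTo-zero (suc k) f f≡0 = trans (cong₂ _+_ (sumTo-zero k f f≡0) (f≡0 (suc k))) (+-identityˡ 0ℚ)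

⊗-suc : ∀ p q k → (p ⊗ q) (suc k) ≡ p 0 * q (suc k) + ((λ i → p (suc i)) ⊗ q) k
⊗-suc p q k = sumTo-suc k (λ i → p i * q (suc k ∸ i))

⊗-constantˡ : ∀ p q → (∀ i → p (suc i) ≡ 0ℚ) → ∀ k → (p ⊗ q) k ≡ p 0 * q k
⊗-constantˡ p q p-constant zero    = refl
⊗-constantˡ p q p-constant (suc k) = begin
  (p ⊗ q) (suc k)
    ≡⟨ ⊗-suc p q k ⟩
  p 0 * q (suc k) + ((λ i → p (suc i)) ⊗ q) k
    ≡⟨ cong (p 0 * q (suc k) +_) (sumTo-zero k (λ i → p (suc i) * q (k ∸ i)) higher≡0) ⟩
  p 0 * q (suc k) + 0ℚ
    ≡⟨ +-identityʳ (p 0 * q (suc k)) ⟩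
  p 0 * q (suc k)
    ∎
  where
  higher≡0 : ∀ i → p (suc i) * q (k ∸ i) ≡ 0ℚ
  higher≡0 i = trans (cong (_* q (k ∸ i)) (p-constant i)) (*-zeroˡ (q (k ∸ i)))

⊗-linearˡ-suc : ∀ p q → (∀ i → p (2 ℕ.+ i) ≡ 0ℚ) → ∀ k →
                (p ⊗ q) (suc k) ≡ p 0 * q (suc k) + p 1 * q k
⊗-linearˡ-suc p q p-linear k =
  trans (⊗-suc p q k) (cong (p 0 * q (suc k) +_) (⊗-constantˡ (λ i → p (suc i)) q p-linear k))

const⊗T : ∀ C k → (const C ⊗ T) k ≡ C * T k
const⊗T C = ⊗-constantˡ (const C) T (λ _ → refl)

linear : ℚ → ℚ → Poly
linear A B = const A ⊗ T ⊕ const B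

linear⊗-suc : ∀ A B q k → (linear A B ⊗ q) (suc k) ≡ B * q (suc k) + A * q k
linear⊗-suc A B q k = begin
  (linear A B ⊗ q) (suc k)                        ≡⟨ ⊗-linearˡ-suc (linear A B) q degree≤1 k ⟩
  linear A B 0 * q (suc k) + linear A B 1 * q k   ≡⟨ cong₂ (λ b a → b * q (suc k) + a * q k) [t⁰] [t¹] ⟩
  B * q (suc k) + A * q k                         ∎
  where
  [t⁰] : linear A B 0 ≡ B
  [t⁰] = trans (cong (_+ B) (*-zeroʳ A)) (+-identityˡ B)
  [t¹] : linear A B 1 ≡ A
  [t¹] = trans (+-identityʳ ((const A ⊗ T) 1)) (trans (const⊗T A 1) (*-identityʳ A))
  degree≤1 : ∀ i → linear A B (2 ℕ.+ i) ≡ 0ℚ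
  degree≤1 i = trans (+-identityʳ ((const A ⊗ T) (2 ℕ.+ i))) (trans (const⊗T A (2 ℕ.+ i)) (*-zeroʳ A))

scaled-t[t+1] : ℚ → Poly
scaled-t[t+1] C = const C ⊗ T ⊗ (T ⊕ const (ℕ→ℚ 1))

scaled-t[t+1]-zero : ∀ C → scaled-t[t+1] C 0 ≡ 0ℚ
scaled-t[t+1]-zero C = trans (cong (_* t+1) (*-zeroʳ C)) (*-zeroˡ t+1)
  where
  t+1 : ℚ
  t+1 = (T ⊕ const (ℕ→ℚ 1)) 0

scaled-t[t+1]-suc : ∀ C k → scaled-t[t+1] C (suc k) ≡ C * (T ⊕ const (ℕ→ℚ 1)) k
scaled-t[t+1]-suc C k = begin
  scaled-t[t+1] C (suc k)
    ≡⟨ ⊗-linearˡ-suc (const C ⊗ T) t+1 degree≤1 k ⟩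
  (const C ⊗ T) 0 * t+1 (suc k) + (const C ⊗ T) 1 * t+1 k
    ≡⟨ cong₂ (λ a b → a * t+1 (suc k) + b * t+1 k) (*-zeroʳ C) [t¹] ⟩
  0ℚ * t+1 (suc k) + C * t+1 k
    ≡⟨ cong (_+ C * t+1 k) (*-zeroˡ (t+1 (suc k))) ⟩
  0ℚ + C * t+1 k
    ≡⟨ +-identityˡ (C * t+1 k) ⟩
  C * t+1 k
    ∎
  where
  t+1 : Poly
  t+1 = T ⊕ const (ℕ→ℚ 1)
  [t¹] : (const C ⊗ T) 1 ≡ C
  [t¹] = trans (const⊗T C 1) (*-identityʳ C)
  degree≤1 : ∀ i → (const C ⊗ T) (2 ℕ.+ i) ≡ 0ℚ
  degree≤1 i = trans (const⊗T C (2 ℕ.+ i)) (*-zeroʳ C)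

scaled-t[t+1]⊗deriv-suc : ∀ C q r →
  (scaled-t[t+1] C ⊗ deriv q) (suc r) ≡ C * (ℕ→ℚ (suc r) * q (suc r)) + C * (ℕ→ℚ r * q r)
scaled-t[t+1]⊗deriv-suc C q r = begin
  (S ⊗ deriv q) (suc r)
    ≡⟨ ⊗-suc S (deriv q) r ⟩
  S 0 * deriv q (suc r) + ((λ i → S (suc i)) ⊗ deriv q) r
    ≡⟨ cong₂ _+_ [t⁰] (shifted r) ⟩
  0ℚ + (C * deriv q r + C * (ℕ→ℚ r * q r))
    ≡⟨ +-identityˡ (C * deriv q r + C * (ℕ→ℚ r * q r)) ⟩
  C * deriv q r + C * (ℕ→ℚ r * q r)
    ∎
  where
  S : Poly
  S = scaled-t[t+1] C
  [t⁰] : S 0 * deriv q (suc r) ≡ 0ℚ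
  [t⁰] = trans (cong (_* deriv q (suc r)) (scaled-t[t+1]-zero C)) (*-zeroˡ (deriv q (suc r)))
  [t¹] : S 1 ≡ C
  [t¹] = trans (scaled-t[t+1]-suc C 0) (trans (cong (C *_) (+-identityˡ 1ℚ)) (*-identityʳ C))
  [t²] : S 2 ≡ C
  [t²] = trans (scaled-t[t+1]-suc C 1) (trans (cong (C *_) (+-identityʳ 1ℚ)) (*-identityʳ C))
  degree≤2 : ∀ i → S (3 ℕ.+ i) ≡ 0ℚ
  degree≤2 i = trans (scaled-t[t+1]-suc C (2 ℕ.+ i)) (trans (cong (C *_) (+-identityʳ 0ℚ)) (*-zeroʳ C))
  x≡x+C*[0*z] : ∀ x C z → x ≡ x + C * (0ℚ * z)
  x≡x+C*[0*z] = RingSolver.solve-∀ ℚ-ring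
  shifted : ∀ k → ((λ i → S (suc i)) ⊗ deriv q) k ≡ C * deriv q k + C * (ℕ→ℚ k * q k)
  shifted zero    = trans (cong (_* deriv q 0) [t¹]) (x≡x+C*[0*z] (C * deriv q 0) C (q 0))
  shifted (suc k) = trans (⊗-linearˡ-suc (λ i → S (suc i)) (deriv q) degree≤2 k)
                          (cong₂ (λ a b → a * deriv q (suc k) + b * deriv q k) [t¹] [t²])

g-vanishes : ∀ n d j → ¬ (suc j ≤ d ⊓ (n ∸ d)) → g n d (suc j) ≡ 0ℚ
g-vanishes n d j j∉ with suc j ≤? d ⊓ (n ∸ d)
... | yes j∈ = ⊥-elim (j∉ j∈)
... | no  _  = refl

g-inside : ∀ n d j → suc j ≤ d ⊓ (n ∸ d) →
  g n d (suc j) ≡ ℕ→ℚ ((n ∸ suc j ∸ 1) !) ÷ ℕ→ℚ ((d ∸ suc j) ! ℕ.* (n ∸ d ∸ suc j) ! ℕ.* j !)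
g-inside n d j j∈ with suc j ≤? d ⊓ (n ∸ d)
... | yes _  = refl
... | no  j∉ = ⊥-elim (j∉ j∈)

g-vanishes-≥d : ∀ n d j → d ≤ j → g n d (suc j) ≡ 0ℚ
g-vanishes-≥d n d j d≤j =
  g-vanishes n d j (λ j∈ → ℕ.<⇒≱ (ℕ.m≤n⊓o⇒m≤n d (n ∸ d) j∈) d≤j)

g-vanishes-≥n : ∀ n d j → n < d ℕ.+ suc j → g n d (suc j) ≡ 0ℚ
g-vanishes-≥n n d j n<d+1+j =
  g-vanishes n d j (λ j∈ → ℕ.<⇒≱ n<d+1+j (d+1+j≤n (ℕ.m≤n⊓o⇒m≤o d (n ∸ d) j∈)))
  where
  d+1+j≤n : suc j ≤ n ∸ d → d ℕ.+ suc j ≤ n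
  d+1+j≤n 1+j≤n∸d = subst (_≤ n) (ℕ.+-comm (suc j) d) (ℕ.m≤o∸n⇒m+n≤o (suc j) d≤n 1+j≤n∸d)
    where
    d≤n : d ≤ n
    d≤n = ℕ.<⇒≤ (ℕ.m∸n≢0⇒n<m (λ n∸d≡0 → ℕ.n≮0 (subst (suc j ≤_) n∸d≡0 1+j≤n∸d)))

g-multinomial : ∀ {n d} x y j → d ≡ x ℕ.+ suc j → n ≡ d ℕ.+ y ℕ.+ suc j →
  g n d (suc j) * ℕ→ℚ (x ! ℕ.* y ! ℕ.* j !) ≡ ℕ→ℚ ((x ℕ.+ y ℕ.+ j) !)
g-multinomial x y j refl refl = begin
  g n d (suc j) * Δ
    ≡⟨ cong (_* Δ) (g-inside n d j j∈) ⟩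
  ℕ→ℚ ((n ∸ suc j ∸ 1) !) ÷ ℕ→ℚ ((d ∸ suc j) ! ℕ.* (n ∸ d ∸ suc j) ! ℕ.* j !) * Δ
    ≡⟨ cong₂ (λ a b → ℕ→ℚ (a !) ÷ ℕ→ℚ (b ℕ.* j !) * Δ) n∸[1+j]∸1≡x+y+j
             (cong₂ (λ a b → a ! ℕ.* b !) d∸[1+j]≡x n∸d∸[1+j]≡y) ⟩
  ℕ→ℚ ((x ℕ.+ y ℕ.+ j) !) ÷ Δ * Δ
    ≡⟨ ÷-*-cancel (ℕ→ℚ ((x ℕ.+ y ℕ.+ j) !)) (ℕ→ℚ[x!y!z!]≢0 x y j) ⟩
  ℕ→ℚ ((x ℕ.+ y ℕ.+ j) !)
    ∎
  where
  Δ : ℚ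
  Δ = ℕ→ℚ (x ! ℕ.* y ! ℕ.* j !)
  d n : ℕ
  d = x ℕ.+ suc j
  n = d ℕ.+ y ℕ.+ suc j
  n∸d≡y+[1+j] : n ∸ d ≡ y ℕ.+ suc j
  n∸d≡y+[1+j] = trans (cong (_∸ d) (ℕ.+-assoc d y (suc j))) (ℕ.m+n∸m≡n d (y ℕ.+ suc j))
  j∈ : suc j ≤ d ⊓ (n ∸ d)
  j∈ = ℕ.⊓-glb (ℕ.m≤n+m (suc j) x) (subst (suc j ≤_) (sym n∸d≡y+[1+j]) (ℕ.m≤n+m (suc j) y))
  d∸[1+j]≡x : d ∸ suc j ≡ x
  d∸[1+j]≡x = ℕ.m+n∸n≡m x (suc j)
  n∸d∸[1+j]≡y : n ∸ d ∸ suc j ≡ y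
  n∸d∸[1+j]≡y = trans (cong (_∸ suc j) n∸d≡y+[1+j]) (ℕ.m+n∸n≡m y (suc j))
  n≡x+y+j+[2+j] : ∀ x y j → x ℕ.+ suc j ℕ.+ y ℕ.+ suc j ≡ x ℕ.+ y ℕ.+ j ℕ.+ (suc j ℕ.+ 1)
  n≡x+y+j+[2+j] = solve-∀
  n∸[1+j]∸1≡x+y+j : n ∸ suc j ∸ 1 ≡ x ℕ.+ y ℕ.+ j
  n∸[1+j]∸1≡x+y+j = begin
    n ∸ suc j ∸ 1                                  ≡⟨ ℕ.∸-+-assoc n (suc j) 1 ⟩
    n ∸ (suc j ℕ.+ 1)                              ≡⟨ cong (_∸ (suc j ℕ.+ 1)) (n≡x+y+j+[2+j] x y j) ⟩
    x ℕ.+ y ℕ.+ j ℕ.+ (suc j ℕ.+ 1) ∸ (suc j ℕ.+ 1) ≡⟨ ℕ.m+n∸n≡m (x ℕ.+ y ℕ.+ j) (suc j ℕ.+ 1) ⟩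
    x ℕ.+ y ℕ.+ j                                  ∎

g-multinomial-scaled : ∀ {n d j s Δ} x y m → d ≡ x ℕ.+ suc j → n ≡ d ℕ.+ y ℕ.+ suc j →
  x ℕ.+ y ℕ.+ j ≡ s → Δ ≡ x ! ℕ.* y ! ℕ.* j ! ℕ.* m →
  g n d (suc j) * ℕ→ℚ Δ ≡ ℕ→ℚ m * ℕ→ℚ (s !)
g-multinomial-scaled {n} {d} {j} x y m d≡ n≡ refl refl = begin
  g n d (suc j) * ℕ→ℚ (x ! ℕ.* y ! ℕ.* j ! ℕ.* m)     ≡⟨ cong (g n d (suc j) *_) (ℕ→ℚ-* Δ m) ⟩
  g n d (suc j) * (ℕ→ℚ Δ * ℕ→ℚ m)                     ≡⟨ *-assoc (g n d (suc j)) (ℕ→ℚ Δ) (ℕ→ℚ m) ⟨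
  g n d (suc j) * ℕ→ℚ Δ * ℕ→ℚ m                       ≡⟨ cong (_* ℕ→ℚ m) (g-multinomial x y j d≡ n≡) ⟩
  ℕ→ℚ ((x ℕ.+ y ℕ.+ j) !) * ℕ→ℚ m                     ≡⟨ *-comm (ℕ→ℚ ((x ℕ.+ y ℕ.+ j) !)) (ℕ→ℚ m) ⟩
  ℕ→ℚ m * ℕ→ℚ ((x ℕ.+ y ℕ.+ j) !)                     ∎
  where
  Δ : ℕ
  Δ = x ! ℕ.* y ! ℕ.* j !

vanishing-scaled : ∀ {v P} → v ≡ 0ℚ → P ≡ 0ℚ → ∀ Δ F → v * Δ ≡ P * F
vanishing-scaled refl refl Δ F = trans (*-zeroˡ Δ) (sym (*-zeroˡ F))

<-of-+suc : ∀ {a b} k → b ≡ a ℕ.+ suc k → a < b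
<-of-+suc {a} k refl = ℕ.m<m+n a (s≤s z≤n)

g[d]-scaled : ∀ {n d r s} x y → d ≡ x ℕ.+ suc r → n ≡ x ℕ.+ y ℕ.+ r ℕ.+ r → x ℕ.+ y ℕ.+ r ≡ 2 ℕ.+ s →
  g n d (suc r) * ℕ→ℚ (x ! ℕ.* y ! ℕ.* r !) ≡ ℕ→ℚ y * (ℕ→ℚ y - 1ℚ) * ℕ→ℚ (s !)
g[d]-scaled {r = r} {s} x 0 refl refl _ =
  vanishing-scaled (g-vanishes-≥n (x ℕ.+ 0 ℕ.+ r ℕ.+ r) (x ℕ.+ suc r) r (<-of-+suc 1 (shape x r)))
    (*-zeroˡ (ℕ→ℚ 0 - 1ℚ)) (ℕ→ℚ (x ! ℕ.* 0 ! ℕ.* r !)) (ℕ→ℚ (s !))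
  where
  shape : ∀ x r → x ℕ.+ suc r ℕ.+ suc r ≡ x ℕ.+ 0 ℕ.+ r ℕ.+ r ℕ.+ 2
  shape = solve-∀
g[d]-scaled {r = r} {s} x 1 refl refl _ =
  vanishing-scaled (g-vanishes-≥n (x ℕ.+ 1 ℕ.+ r ℕ.+ r) (x ℕ.+ suc r) r (<-of-+suc 0 (shape x r)))
    (*-zeroʳ (ℕ→ℚ 1)) (ℕ→ℚ (x ! ℕ.* 1 ! ℕ.* r !)) (ℕ→ℚ (s !))
  where
  shape : ∀ x r → x ℕ.+ suc r ℕ.+ suc r ≡ x ℕ.+ 1 ℕ.+ r ℕ.+ r ℕ.+ 1
  shape = solve-∀
g[d]-scaled {r = r} {s} x (suc (suc y)) refl refl x+y+r≡2+s = trans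
  (g-multinomial-scaled x y (suc (suc y) ℕ.* suc y) refl (shape x y r)
    (ℕ.+-cancelˡ-≡ 2 _ _ (trans (sum x y r) x+y+r≡2+s)) (regroup (x !) (y !) (r !) (suc (suc y)) (suc y)))
  (cong (_* ℕ→ℚ (s !)) (ℕ→ℚ[1+m]*m (suc y)))
  where
  shape : ∀ x y r → x ℕ.+ (2 ℕ.+ y) ℕ.+ r ℕ.+ r ≡ x ℕ.+ suc r ℕ.+ y ℕ.+ suc r
  shape = solve-∀
  sum : ∀ x y r → 2 ℕ.+ (x ℕ.+ y ℕ.+ r) ≡ x ℕ.+ (2 ℕ.+ y) ℕ.+ r
  sum = solve-∀
  regroup : ∀ a b c u v → a ℕ.* (u ℕ.* (v ℕ.* b)) ℕ.* c ≡ a ℕ.* b ℕ.* c ℕ.* (u ℕ.* v)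
  regroup = solve-∀

g[d-1]-scaled : ∀ {n d r s} x y → d ≡ x ℕ.+ suc r → n ≡ x ℕ.+ y ℕ.+ r ℕ.+ r → x ℕ.+ y ℕ.+ r ≡ 2 ℕ.+ s →
  g n (d ∸ 1) (suc r) * ℕ→ℚ (x ! ℕ.* y ! ℕ.* r !) ≡ ℕ→ℚ x * ℕ→ℚ y * ℕ→ℚ (s !)
g[d-1]-scaled {r = r} {s} 0 y refl refl _ =
  vanishing-scaled (g-vanishes-≥d (0 ℕ.+ y ℕ.+ r ℕ.+ r) r r ℕ.≤-refl)
    (*-zeroˡ (ℕ→ℚ y)) (ℕ→ℚ (0 ! ℕ.* y ! ℕ.* r !)) (ℕ→ℚ (s !))
g[d-1]-scaled {r = r} {s} (suc x) 0 refl refl _ =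
  vanishing-scaled (g-vanishes-≥n (suc x ℕ.+ 0 ℕ.+ r ℕ.+ r) (x ℕ.+ suc r) r (<-of-+suc 0 (shape x r)))
    (*-zeroʳ (ℕ→ℚ (suc x))) (ℕ→ℚ (suc x ! ℕ.* 0 ! ℕ.* r !)) (ℕ→ℚ (s !))
  where
  shape : ∀ x r → x ℕ.+ suc r ℕ.+ suc r ≡ suc x ℕ.+ 0 ℕ.+ r ℕ.+ r ℕ.+ 1
  shape = solve-∀
g[d-1]-scaled {r = r} {s} (suc x) (suc y) refl refl x+y+r≡2+s = trans
  (g-multinomial-scaled x y (suc x ℕ.* suc y) refl (shape x y r)
    (ℕ.+-cancelˡ-≡ 2 _ _ (trans (sum x y r) x+y+r≡2+s)) (regroup (x !) (y !) (r !) (suc x) (suc y)))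
  (cong (_* ℕ→ℚ (s !)) (ℕ→ℚ-* (suc x) (suc y)))
  where
  shape : ∀ x y r → suc x ℕ.+ suc y ℕ.+ r ℕ.+ r ≡ x ℕ.+ suc r ℕ.+ y ℕ.+ suc r
  shape = solve-∀
  sum : ∀ x y r → 2 ℕ.+ (x ℕ.+ y ℕ.+ r) ≡ suc x ℕ.+ suc y ℕ.+ r
  sum = solve-∀
  regroup : ∀ a b c u v → u ℕ.* a ℕ.* (v ℕ.* b) ℕ.* c ≡ a ℕ.* b ℕ.* c ℕ.* (u ℕ.* v)
  regroup = solve-∀

g[d-1]′-scaled : ∀ {n d r s} x y → d ≡ x ℕ.+ suc r → n ≡ x ℕ.+ y ℕ.+ r ℕ.+ r → x ℕ.+ y ℕ.+ r ≡ 2 ℕ.+ s →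
  g n (d ∸ 1) r * ℕ→ℚ (x ! ℕ.* y ! ℕ.* r !) ≡ ℕ→ℚ r * (ℕ→ℚ x + ℕ→ℚ y + ℕ→ℚ r - 1ℚ) * ℕ→ℚ (s !)
g[d-1]′-scaled {r = zero} {s} x y refl refl _ =
  vanishing-scaled refl (*-zeroˡ (ℕ→ℚ x + ℕ→ℚ y + ℕ→ℚ 0 - 1ℚ)) (ℕ→ℚ (x ! ℕ.* y ! ℕ.* 0 !)) (ℕ→ℚ (s !))
g[d-1]′-scaled {r = suc r} {s} x y refl refl x+y+r≡2+s = begin
  g n (x ℕ.+ suc (suc r) ∸ 1) (suc r) * ℕ→ℚ (x ! ℕ.* y ! ℕ.* suc r !)
    ≡⟨ g-multinomial-scaled x y (suc r) d-1≡ n≡ (ℕ.suc-injective (trans (sum x y r) x+y+r≡2+s))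
         (regroup (x !) (y !) (r !) (suc r)) ⟩
  ℕ→ℚ (suc r) * ℕ→ℚ (suc s ℕ.* s !)
    ≡⟨ cong (ℕ→ℚ (suc r) *_) (ℕ→ℚ-* (suc s) (s !)) ⟩
  ℕ→ℚ (suc r) * (ℕ→ℚ (suc s) * ℕ→ℚ (s !))
    ≡⟨ *-assoc (ℕ→ℚ (suc r)) (ℕ→ℚ (suc s)) (ℕ→ℚ (s !)) ⟨
  ℕ→ℚ (suc r) * ℕ→ℚ (suc s) * ℕ→ℚ (s !)
    ≡⟨ cong (λ z → ℕ→ℚ (suc r) * z * ℕ→ℚ (s !)) ℕ→ℚ[1+s] ⟩
  ℕ→ℚ (suc r) * (ℕ→ℚ x + ℕ→ℚ y + ℕ→ℚ (suc r) - 1ℚ) * ℕ→ℚ (s !)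
    ∎
  where
  n : ℕ
  n = x ℕ.+ y ℕ.+ suc r ℕ.+ suc r
  d-1≡ : x ℕ.+ suc (suc r) ∸ 1 ≡ x ℕ.+ suc r
  d-1≡ = cong (_∸ 1) (ℕ.+-suc x (suc r))
  shape : ∀ x y r → x ℕ.+ y ℕ.+ suc r ℕ.+ suc r ≡ x ℕ.+ suc r ℕ.+ y ℕ.+ suc r
  shape = solve-∀
  n≡ : n ≡ x ℕ.+ suc (suc r) ∸ 1 ℕ.+ y ℕ.+ suc r
  n≡ = trans (shape x y r) (cong (λ e → e ℕ.+ y ℕ.+ suc r) (sym d-1≡))
  sum : ∀ x y r → suc (x ℕ.+ y ℕ.+ r) ≡ x ℕ.+ y ℕ.+ suc r
  sum = solve-∀
  regroup : ∀ a b c u → a ℕ.* b ℕ.* (u ℕ.* c) ≡ a ℕ.* b ℕ.* c ℕ.* u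
  regroup = solve-∀
  ℕ→ℚ[1+s] : ℕ→ℚ (suc s) ≡ ℕ→ℚ x + ℕ→ℚ y + ℕ→ℚ (suc r) - 1ℚ
  ℕ→ℚ[1+s] = begin
    ℕ→ℚ (suc s)                              ≡⟨ ℕ→ℚ-pred (suc s) ⟨
    ℕ→ℚ (2 ℕ.+ s) - 1ℚ                       ≡⟨ cong (λ k → ℕ→ℚ k - 1ℚ) x+y+r≡2+s ⟨
    ℕ→ℚ (x ℕ.+ y ℕ.+ suc r) - 1ℚ             ≡⟨ cong (_- 1ℚ) (ℕ→ℚ-+₃ x y (suc r)) ⟩
    ℕ→ℚ x + ℕ→ℚ y + ℕ→ℚ (suc r) - 1ℚ        ∎

g[d-2]-scaled : ∀ {n d r s} x y → d ≡ x ℕ.+ suc r → n ≡ x ℕ.+ y ℕ.+ r ℕ.+ r → x ℕ.+ y ℕ.+ r ≡ 2 ℕ.+ s →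
  g n (d ∸ 2) (suc r) * ℕ→ℚ (x ! ℕ.* y ! ℕ.* r !) ≡ ℕ→ℚ x * (ℕ→ℚ x - 1ℚ) * ℕ→ℚ (s !)
g[d-2]-scaled {r = r} {s} 0 y refl refl _ =
  vanishing-scaled (g-vanishes-≥d (0 ℕ.+ y ℕ.+ r ℕ.+ r) (r ∸ 1) r (ℕ.m∸n≤m r 1))
    (*-zeroˡ (ℕ→ℚ 0 - 1ℚ)) (ℕ→ℚ (0 ! ℕ.* y ! ℕ.* r !)) (ℕ→ℚ (s !))
g[d-2]-scaled {r = r} {s} 1 y refl refl _ =
  vanishing-scaled (g-vanishes-≥d (1 ℕ.+ y ℕ.+ r ℕ.+ r) r r ℕ.≤-refl)
    (*-zeroʳ (ℕ→ℚ 1)) (ℕ→ℚ (1 ! ℕ.* y ! ℕ.* r !)) (ℕ→ℚ (s !))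
g[d-2]-scaled {r = r} {s} (suc (suc x)) y refl refl x+y+r≡2+s = trans
  (g-multinomial-scaled x y (suc (suc x) ℕ.* suc x) refl (shape x y r)
    (ℕ.+-cancelˡ-≡ 2 _ _ x+y+r≡2+s) (regroup (x !) (y !) (r !) (suc (suc x)) (suc x)))
  (cong (_* ℕ→ℚ (s !)) (ℕ→ℚ[1+m]*m (suc x)))
  where
  shape : ∀ x y r → 2 ℕ.+ x ℕ.+ y ℕ.+ r ℕ.+ r ≡ x ℕ.+ suc r ℕ.+ y ℕ.+ suc r
  shape = solve-∀
  regroup : ∀ a b c u v → u ℕ.* (v ℕ.* a) ℕ.* b ℕ.* c ≡ a ℕ.* b ℕ.* c ℕ.* (u ℕ.* v)
  regroup = solve-∀

record Cell (n d r : ℕ) : Set where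
  field
    x y s     : ℕ
    d≡x+1+r   : d ≡ x ℕ.+ suc r
    n≡x+y+2r  : n ≡ x ℕ.+ y ℕ.+ r ℕ.+ r
    x+y+r≡2+s : x ℕ.+ y ℕ.+ r ≡ 2 ℕ.+ s

module CellValues {n d r : ℕ} (cell : Cell n d r) where
  open Cell cell

  X Y R φ : ℚ
  X = ℕ→ℚ x
  Y = ℕ→ℚ y
  R = ℕ→ℚ r
  φ = ℕ→ℚ (s !) ÷ ℕ→ℚ (x ! ℕ.* y ! ℕ.* r !)

  ℕ→ℚ[n] : ℕ→ℚ n ≡ X + Y + R + R
  ℕ→ℚ[n] = trans (cong ℕ→ℚ n≡x+y+2r) (trans (ℕ→ℚ-+ (x ℕ.+ y ℕ.+ r) r) (cong (_+ R) (ℕ→ℚ-+₃ x y r)))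

  ℕ→ℚ[d] : ℕ→ℚ d ≡ X + (1ℚ + R)
  ℕ→ℚ[d] = trans (cong ℕ→ℚ d≡x+1+r) (trans (ℕ→ℚ-+ x (suc r)) (cong (X +_) (ℕ→ℚ-suc r)))

  private
    unscale : ∀ v P → v * ℕ→ℚ (x ! ℕ.* y ! ℕ.* r !) ≡ P * ℕ→ℚ (s !) → v ≡ P * φ
    unscale v P = v*Δ≡P*F⇒v≡P*[F÷Δ] (ℕ→ℚ[x!y!z!]≢0 x y r) v P (ℕ→ℚ (s !))

  g[d] : g n d (suc r) ≡ Y * (Y - 1ℚ) * φ
  g[d] = unscale (g n d (suc r)) (Y * (Y - 1ℚ))
    (g[d]-scaled x y d≡x+1+r n≡x+y+2r x+y+r≡2+s)

  g[d-1] : g n (d ∸ 1) (suc r) ≡ X * Y * φ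
  g[d-1] = unscale (g n (d ∸ 1) (suc r)) (X * Y)
    (g[d-1]-scaled x y d≡x+1+r n≡x+y+2r x+y+r≡2+s)

  g[d-1]′ : g n (d ∸ 1) r ≡ R * (X + Y + R - 1ℚ) * φ
  g[d-1]′ = unscale (g n (d ∸ 1) r) (R * (X + Y + R - 1ℚ))
    (g[d-1]′-scaled x y d≡x+1+r n≡x+y+2r x+y+r≡2+s)

  g[d-2] : g n (d ∸ 2) (suc r) ≡ X * (X - 1ℚ) * φ
  g[d-2] = unscale (g n (d ∸ 2) (suc r)) (X * (X - 1ℚ))
    (g[d-2]-scaled x y d≡x+1+r n≡x+y+2r x+y+r≡2+s)

cell-of : ∀ {n d₀ r} → 3 ≤ n → r ≤ suc d₀ → d₀ ℕ.+ suc r ≤ n → Cell n (suc (suc d₀)) r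
cell-of {n} {d₀} {r} 3≤n r≤1+d₀ d₀+1+r≤n = record
  { x = x ; y = y ; s = S ∸ 2
  ; d≡x+1+r   = trans (cong suc (sym x+r≡1+d₀)) (sym (ℕ.+-suc x r))
  ; n≡x+y+2r  = n≡
  ; x+y+r≡2+s = sym (ℕ.m+[n∸m]≡n 2≤S)
  }
  where
  x y S : ℕ
  x = suc d₀ ∸ r
  y = n ∸ (d₀ ℕ.+ suc r)
  S = x ℕ.+ y ℕ.+ r
  x+r≡1+d₀ : x ℕ.+ r ≡ suc d₀
  x+r≡1+d₀ = ℕ.m∸n+n≡m r≤1+d₀
  rearrange : ∀ x y r → x ℕ.+ r ℕ.+ r ℕ.+ y ≡ x ℕ.+ y ℕ.+ r ℕ.+ r
  rearrange = solve-∀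
  n≡ : n ≡ x ℕ.+ y ℕ.+ r ℕ.+ r
  n≡ = begin
    n                        ≡⟨ ℕ.m+[n∸m]≡n d₀+1+r≤n ⟨
    d₀ ℕ.+ suc r ℕ.+ y       ≡⟨ cong (ℕ._+ y) (trans (ℕ.+-suc d₀ r) (cong (ℕ._+ r) (sym x+r≡1+d₀))) ⟩
    x ℕ.+ r ℕ.+ r ℕ.+ y      ≡⟨ rearrange x y r ⟩
    x ℕ.+ y ℕ.+ r ℕ.+ r      ∎
  2≤S : 2 ≤ S
  2≤S = ℕ.≰⇒> λ S≤1 → ℕ.<⇒≱ 3≤n
    (subst (_≤ 2) (sym n≡) (ℕ.+-mono-≤ S≤1 (ℕ.≤-trans (ℕ.m≤n+m r (x ℕ.+ y)) S≤1)))

record Vanishes (n d r : ℕ) : Set where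
  field
    g[d]    : g n d (suc r) ≡ 0ℚ
    g[d-1]  : g n (d ∸ 1) (suc r) ≡ 0ℚ
    g[d-1]′ : g n (d ∸ 1) r ≡ 0ℚ
    g[d-2]  : g n (d ∸ 2) (suc r) ≡ 0ℚ

vanishes-beyond-d : ∀ {n d r} → d ≤ r → Vanishes n d r
vanishes-beyond-d {n} {d} {r} d≤r = record
  { g[d]    = g-vanishes-≥d n d r d≤r
  ; g[d-1]  = g-vanishes-≥d n (d ∸ 1) r (ℕ.≤-trans (ℕ.m∸n≤m d 1) d≤r)
  ; g[d-1]′ = lower r d≤r
  ; g[d-2]  = g-vanishes-≥d n (d ∸ 2) r (ℕ.≤-trans (ℕ.m∸n≤m d 2) d≤r)
  }
  where
  lower : ∀ r → d ≤ r → g n (d ∸ 1) r ≡ 0ℚ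
  lower zero    _     = refl
  lower (suc r) d≤1+r = g-vanishes-≥d n (d ∸ 1) r (ℕ.∸-monoˡ-≤ 1 d≤1+r)

vanishes-beyond-n : ∀ {n d₀ r} → n < d₀ ℕ.+ suc r → Vanishes n (suc (suc d₀)) r
vanishes-beyond-n {n} {d₀} {r} n<d₀+1+r = record
  { g[d]    = g-vanishes-≥n n (suc (suc d₀)) r (ℕ.<-≤-trans n<d₀+1+r (ℕ.m≤n+m (d₀ ℕ.+ suc r) 2))
  ; g[d-1]  = g-vanishes-≥n n (suc d₀) r (ℕ.<-≤-trans n<d₀+1+r (ℕ.m≤n+m (d₀ ℕ.+ suc r) 1))
  ; g[d-1]′ = lower r n<d₀+1+r
  ; g[d-2]  = g-vanishes-≥n n d₀ r n<d₀+1+r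
  }
  where
  lower : ∀ r → n < d₀ ℕ.+ suc r → g n (suc d₀) r ≡ 0ℚ
  lower zero    _  = refl
  lower (suc r) n< = g-vanishes-≥n n (suc d₀) r (subst (n <_) (ℕ.+-suc d₀ (suc r)) n<)

vanishing-recurrence₁ : ∀ {n d r} → Vanishes n d r → ∀ A B E →
  g n d (suc r) ≡ B * g n (d ∸ 1) (suc r) + A * g n (d ∸ 1) r - E * g n (d ∸ 2) (suc r)
vanishing-recurrence₁ {n} {d} {r} vanishes A B E = begin
  g n d (suc r)
    ≡⟨ g[d] ⟩
  0ℚ
    ≡⟨ 0≡combination A B E ⟩
  B * 0ℚ + A * 0ℚ - E * 0ℚ
    ≡⟨ cong₂ _-_ (cong₂ (λ u v → B * u + A * v) g[d-1] g[d-1]′) (cong (E *_) g[d-2]) ⟨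
  B * g n (d ∸ 1) (suc r) + A * g n (d ∸ 1) r - E * g n (d ∸ 2) (suc r)
    ∎
  where
  open Vanishes vanishes
  0≡combination : ∀ A B E → 0ℚ ≡ B * 0ℚ + A * 0ℚ - E * 0ℚ
  0≡combination = RingSolver.solve-∀ ℚ-ring

vanishing-recurrence₂ : ∀ {n d r} → Vanishes n d r → ∀ A B E →
  g n d (suc r) ≡ B * g n (d ∸ 1) (suc r) + A * g n (d ∸ 1) r
                  - (E * (ℕ→ℚ (suc r) * g n (d ∸ 1) (suc r)) + E * (ℕ→ℚ r * g n (d ∸ 1) r))
vanishing-recurrence₂ {n} {d} {r} vanishes A B E = begin
  g n d (suc r)
    ≡⟨ g[d] ⟩
  0ℚ
    ≡⟨ 0≡combination A B E (ℕ→ℚ (suc r)) (ℕ→ℚ r) ⟩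
  B * 0ℚ + A * 0ℚ - (E * (ℕ→ℚ (suc r) * 0ℚ) + E * (ℕ→ℚ r * 0ℚ))
    ≡⟨ cong₂ (λ u v → B * u + A * v - (E * (ℕ→ℚ (suc r) * u) + E * (ℕ→ℚ r * v))) g[d-1] g[d-1]′ ⟨
  B * g n (d ∸ 1) (suc r) + A * g n (d ∸ 1) r
    - (E * (ℕ→ℚ (suc r) * g n (d ∸ 1) (suc r)) + E * (ℕ→ℚ r * g n (d ∸ 1) r))
    ∎
  where
  open Vanishes vanishes
  0≡combination : ∀ A B E u v → 0ℚ ≡ B * 0ℚ + A * 0ℚ - (E * (u * 0ℚ) + E * (v * 0ℚ))
  0≡combination = RingSolver.solve-∀ ℚ-ring

vanishes-or-cell : ∀ {n d r} → 3 ≤ n → 2 ≤ d → Vanishes n d r ⊎ Cell n d r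
vanishes-or-cell {d = 0}             _   ()
vanishes-or-cell {d = 1}             _   (s≤s ())
vanishes-or-cell {n} {suc (suc d₀)} {r} 3≤n _ with suc (suc d₀) ≤? r | suc n ≤? d₀ ℕ.+ suc r
... | yes d≤r | _       = inj₁ (vanishes-beyond-d d≤r)
... | no  _   | yes n<  = inj₁ (vanishes-beyond-n n<)
... | no  d≰r | no  n≮  = inj₂ (cell-of 3≤n (ℕ.≤-pred (ℕ.≰⇒> d≰r)) (ℕ.≤-pred (ℕ.≰⇒> n≮)))

den₁ a₁ b₁ e₁ den₂ a₂ b₂ e₂ : ℕ → ℕ → ℚ
den₁ n d = ℕ→ℚ (d ∸ 1) * ℕ→ℚ (n ∸ d) * c d (n ℕ.+ 2)
a₁ n d = (c d (n ℕ.+ 1) * c d n * c d (n ℕ.+ 2)) ÷ den₁ n d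
b₁ n d = (c d (n ℕ.+ 1) * (ℕ→ℚ (n ∸ d) * ℕ→ℚ (n ∸ d) + ℕ→ℚ (d ∸ 2) * ℕ→ℚ (d ∸ 2) + ℕ→ℚ (n ∸ 2))) ÷ den₁ n d
e₁ n d = (ℕ→ℚ (d ∸ 2) * ℕ→ℚ (n ℕ.+ 1 ∸ d) * c d n) ÷ den₁ n d
den₂ n d = ℕ→ℚ (d ∸ 1) * ℕ→ℚ (n ∸ d)
a₂ n d = (c d n * ℕ→ℚ (n ℕ.+ 1 ∸ d)) ÷ den₂ n d
b₂ n d = (ℕ→ℚ (n ∸ d) * ℕ→ℚ (n ∸ d) + ℕ→ℚ n - ℕ→ℚ (2 ℕ.* d) + ℕ→ℚ 1) ÷ den₂ n d
e₂ n d = c d n ÷ den₂ n d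

-- The recurrences at t^(r+1) in a cell, denominators cleared; N and D stand for n and d.
recurrence₁-identity : ∀ X Y R φ →
  let N = X + Y + R + R
      D = X + (1ℚ + R)
      c′ = λ M → M + 1ℚ - ℕ→ℚ 2 * D in
  Y * (Y - 1ℚ) * φ * ((D - 1ℚ) * (N - D) * c′ (N + ℕ→ℚ 2))
  ≡ c′ (N + 1ℚ) * ((N - D) * (N - D) + (D - ℕ→ℚ 2) * (D - ℕ→ℚ 2) + (N - ℕ→ℚ 2)) * (X * Y * φ)
    + c′ (N + 1ℚ) * c′ N * c′ (N + ℕ→ℚ 2) * (R * (X + Y + R - 1ℚ) * φ)
    - (D - ℕ→ℚ 2) * (N + 1ℚ - D) * c′ N * (X * (X - 1ℚ) * φ)
recurrence₁-identity = RingSolver.solve-∀ ℚ-ring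

recurrence₂-identity : ∀ X Y R φ →
  let N = X + Y + R + R
      D = X + (1ℚ + R)
      cₙ = N + 1ℚ - ℕ→ℚ 2 * D in
  Y * (Y - 1ℚ) * φ * ((D - 1ℚ) * (N - D))
  ≡ ((N - D) * (N - D) + N - ℕ→ℚ 2 * D + 1ℚ) * (X * Y * φ)
    + cₙ * (N + 1ℚ - D) * (R * (X + Y + R - 1ℚ) * φ)
    - (cₙ * ((1ℚ + R) * (X * Y * φ)) + cₙ * (R * (R * (X + Y + R - 1ℚ) * φ)))
recurrence₂-identity = RingSolver.solve-∀ ℚ-ring

-- The images under ℕ→ℚ of d ∸ 1, n ∸ d, c d n, ... are abstracted so that the refl patterns
-- replace them by their values in the cell coordinates.
scaled-recurrence₁ : ∀ X Y R φ {N D d-1 n-d d-2 n-2 n+1-d cₙ cₙ₊₁ cₙ₊₂ a b b′ e : ℚ} →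
  N ≡ X + Y + R + R → D ≡ X + (1ℚ + R) →
  d-1 ≡ D - 1ℚ → n-d ≡ N - D → d-2 ≡ D - ℕ→ℚ 2 → n-2 ≡ N - ℕ→ℚ 2 → n+1-d ≡ N + 1ℚ - D →
  cₙ ≡ N + 1ℚ - ℕ→ℚ 2 * D → cₙ₊₁ ≡ N + 1ℚ + 1ℚ - ℕ→ℚ 2 * D → cₙ₊₂ ≡ N + ℕ→ℚ 2 + 1ℚ - ℕ→ℚ 2 * D →
  d-1 * n-d * cₙ₊₂ ≢ 0ℚ →
  a ≡ Y * (Y - 1ℚ) * φ → b ≡ X * Y * φ → b′ ≡ R * (X + Y + R - 1ℚ) * φ → e ≡ X * (X - 1ℚ) * φ →
  a ≡ ((cₙ₊₁ * (n-d * n-d + d-2 * d-2 + n-2)) ÷ (d-1 * n-d * cₙ₊₂)) * b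
      + ((cₙ₊₁ * cₙ * cₙ₊₂) ÷ (d-1 * n-d * cₙ₊₂)) * b′
      - ((d-2 * n+1-d * cₙ) ÷ (d-1 * n-d * cₙ₊₂)) * e
scaled-recurrence₁ X Y R φ {n-d = n-d} {d-2} {n-2} {n+1-d} {cₙ} {cₙ₊₁} {cₙ₊₂} {a} {b} {b′} {e}
  refl refl refl refl refl refl refl refl refl refl den≢0 refl refl refl refl =
  clear-denominator₁ den≢0 a (cₙ₊₁ * (n-d * n-d + d-2 * d-2 + n-2)) (cₙ₊₁ * cₙ * cₙ₊₂) (d-2 * n+1-d * cₙ)
    b b′ e (recurrence₁-identity X Y R φ)

scaled-recurrence₂ : ∀ X Y R φ {N D d-1 n-d n+1-d 2d cₙ r+1 a b b′ : ℚ} →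
  N ≡ X + Y + R + R → D ≡ X + (1ℚ + R) →
  d-1 ≡ D - 1ℚ → n-d ≡ N - D → n+1-d ≡ N + 1ℚ - D → 2d ≡ ℕ→ℚ 2 * D → cₙ ≡ N + 1ℚ - ℕ→ℚ 2 * D →
  r+1 ≡ 1ℚ + R →
  d-1 * n-d ≢ 0ℚ →
  a ≡ Y * (Y - 1ℚ) * φ → b ≡ X * Y * φ → b′ ≡ R * (X + Y + R - 1ℚ) * φ →
  a ≡ ((n-d * n-d + N - 2d + 1ℚ) ÷ (d-1 * n-d)) * b + ((cₙ * n+1-d) ÷ (d-1 * n-d)) * b′
      - ((cₙ ÷ (d-1 * n-d)) * (r+1 * b) + (cₙ ÷ (d-1 * n-d)) * (R * b′))
scaled-recurrence₂ X Y R φ {N} {n-d = n-d} {n+1-d} {2d} {cₙ} {r+1} {a} {b} {b′}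
  refl refl refl refl refl refl refl refl den≢0 refl refl refl =
  clear-denominator₂ den≢0 a (n-d * n-d + N - 2d + 1ℚ) (cₙ * n+1-d) cₙ r+1 R b b′
    (recurrence₂-identity X Y R φ)

interior-recurrence₁ : ∀ {n d r} → Cell n d r → 2 ≤ d → d ≤ n → den₁ n d ≢ 0ℚ →
  g n d (suc r) ≡ b₁ n d * g n (d ∸ 1) (suc r) + a₁ n d * g n (d ∸ 1) r - e₁ n d * g n (d ∸ 2) (suc r)
interior-recurrence₁ {n} {d} cell 2≤d d≤n den≢0 =
  scaled-recurrence₁ X Y R φ ℕ→ℚ[n] ℕ→ℚ[d]
    (ℕ→ℚ-∸ (ℕ.≤-trans (s≤s z≤n) 2≤d)) (ℕ→ℚ-∸ d≤n) (ℕ→ℚ-∸ 2≤d) (ℕ→ℚ-∸ (ℕ.≤-trans 2≤d d≤n))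
    (trans (ℕ→ℚ-∸ (ℕ.m≤n⇒m≤n+o 1 d≤n)) (cong (_- ℕ→ℚ d) (ℕ→ℚ-+ n 1)))
    (c-≡ d n) (c-≡+ d n 1) (c-≡+ d n 2)
    den≢0 g[d] g[d-1] g[d-1]′ g[d-2]
  where open CellValues cell

interior-recurrence₂ : ∀ {n d r} → Cell n d r → 2 ≤ d → d ≤ n → den₂ n d ≢ 0ℚ →
  g n d (suc r) ≡ b₂ n d * g n (d ∸ 1) (suc r) + a₂ n d * g n (d ∸ 1) r
                  - (e₂ n d * (ℕ→ℚ (suc r) * g n (d ∸ 1) (suc r)) + e₂ n d * (ℕ→ℚ r * g n (d ∸ 1) r))
interior-recurrence₂ {n} {d} {r} cell 2≤d d≤n den≢0 =
  scaled-recurrence₂ X Y R φ ℕ→ℚ[n] ℕ→ℚ[d]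
    (ℕ→ℚ-∸ (ℕ.≤-trans (s≤s z≤n) 2≤d)) (ℕ→ℚ-∸ d≤n)
    (trans (ℕ→ℚ-∸ (ℕ.m≤n⇒m≤n+o 1 d≤n)) (cong (_- ℕ→ℚ d) (ℕ→ℚ-+ n 1)))
    (ℕ→ℚ-* 2 d) (c-≡ d n) (ℕ→ℚ-suc r)
    den≢0 g[d] g[d-1] g[d-1]′
  where open CellValues cell

coefficient-recurrence₁ : ∀ {n d} r → 3 ≤ n → 2 ≤ d → d < n → den₁ n d ≢ 0ℚ →
  g n d (suc r) ≡ b₁ n d * g n (d ∸ 1) (suc r) + a₁ n d * g n (d ∸ 1) r - e₁ n d * g n (d ∸ 2) (suc r)
coefficient-recurrence₁ {n} {d} r 3≤n 2≤d d<n den≢0 =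
  [ (λ vanishes → vanishing-recurrence₁ vanishes (a₁ n d) (b₁ n d) (e₁ n d))
  , (λ cell → interior-recurrence₁ cell 2≤d (ℕ.<⇒≤ d<n) den≢0)
  ]′ (vanishes-or-cell {r = r} 3≤n 2≤d)

coefficient-recurrence₂ : ∀ {n d} r → 3 ≤ n → 2 ≤ d → d < n → den₂ n d ≢ 0ℚ →
  g n d (suc r) ≡ b₂ n d * g n (d ∸ 1) (suc r) + a₂ n d * g n (d ∸ 1) r
                  - (e₂ n d * (ℕ→ℚ (suc r) * g n (d ∸ 1) (suc r)) + e₂ n d * (ℕ→ℚ r * g n (d ∸ 1) r))
coefficient-recurrence₂ {n} {d} r 3≤n 2≤d d<n den≢0 =
  [ (λ vanishes → vanishing-recurrence₂ vanishes (a₂ n d) (b₂ n d) (e₂ n d))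
  , (λ cell → interior-recurrence₂ cell 2≤d (ℕ.<⇒≤ d<n) den≢0)
  ]′ (vanishes-or-cell {r = r} 3≤n 2≤d)

≤1+n/2⇒2*d≤n+2 : ∀ {n d} → d ≤ suc (n / 2) → 2 ℕ.* d ≤ n ℕ.+ 2
≤1+n/2⇒2*d≤n+2 {n} d≤1+n/2 =
  ℕ.≤-trans (ℕ.*-monoʳ-≤ 2 d≤1+n/2)
    (subst (_≤ n ℕ.+ 2) (sym (two-halves (n / 2))) (ℕ.+-monoˡ-≤ 2 (m/n*n≤m n 2)))
  where
  two-halves : ∀ h → 2 ℕ.* suc h ≡ h ℕ.* 2 ℕ.+ 2
  two-halves = solve-∀

2*d≤n+2⇒d<n : ∀ {n d} → 3 ≤ n → 2 ℕ.* d ≤ n ℕ.+ 2 → d < n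
2*d≤n+2⇒d<n {n} 3≤n 2d≤n+2 = ℕ.≰⇒> λ n≤d → ℕ.<⇒≱ 3≤n
  (ℕ.+-cancelˡ-≤ n n 2 (subst (_≤ n ℕ.+ 2) (cong (n ℕ.+_) (ℕ.+-identityʳ n))
    (ℕ.≤-trans (ℕ.*-monoʳ-≤ 2 n≤d) 2d≤n+2)))

≤n∸1⇒< : ∀ {n d} → 1 ≤ n → d ≤ n ∸ 1 → d < n
≤n∸1⇒< {suc n} _ d≤n = s≤s d≤n

den₁-≢0 : ∀ {n d} → 2 ≤ d → d < n → 2 ℕ.* d ≤ n ℕ.+ 2 → den₁ n d ≢ 0ℚ
den₁-≢0 {n} {d} 2≤d d<n 2d≤n+2 =
  *-≢0 (*-≢0 (ℕ→ℚ[m∸n]≢0 2≤d) (ℕ→ℚ[m∸n]≢0 d<n)) (c-≢0 d (n ℕ.+ 2) 2d≤n+2)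

den₂-≢0 : ∀ {n d} → 2 ≤ d → d < n → den₂ n d ≢ 0ℚ
den₂-≢0 2≤d d<n = *-≢0 (ℕ→ℚ[m∸n]≢0 2≤d) (ℕ→ℚ[m∸n]≢0 d<n)

recurrence₁ : ∀ n d → 3 ≤ n → 2 ≤ d → d ≤ suc (n / 2) →
  ∀ k → g n d k ≡ (linear (a₁ n d) (b₁ n d) ⊗ g n (d ∸ 1) ⊖ const (e₁ n d) ⊗ g n (d ∸ 2)) k
recurrence₁ n d _ _ _ zero = sym (cong₂ _-_ (*-zeroʳ (linear (a₁ n d) (b₁ n d) 0)) (*-zeroʳ (e₁ n d)))
recurrence₁ n d 3≤n 2≤d d≤1+n/2 (suc r) = begin
  g n d (suc r)
    ≡⟨ coefficient-recurrence₁ r 3≤n 2≤d d<n (den₁-≢0 2≤d d<n 2d≤n+2) ⟩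
  b₁ n d * g n (d ∸ 1) (suc r) + a₁ n d * g n (d ∸ 1) r - e₁ n d * g n (d ∸ 2) (suc r)
    ≡⟨ cong₂ _-_ (linear⊗-suc (a₁ n d) (b₁ n d) (g n (d ∸ 1)) r)
                 (⊗-constantˡ (const (e₁ n d)) (g n (d ∸ 2)) (λ _ → refl) (suc r)) ⟨
  (linear (a₁ n d) (b₁ n d) ⊗ g n (d ∸ 1) ⊖ const (e₁ n d) ⊗ g n (d ∸ 2)) (suc r) ∎
  where
  2d≤n+2 : 2 ℕ.* d ≤ n ℕ.+ 2
  2d≤n+2 = ≤1+n/2⇒2*d≤n+2 d≤1+n/2
  d<n : d < n
  d<n = 2*d≤n+2⇒d<n 3≤n 2d≤n+2

recurrence₂ : ∀ n d → 3 ≤ n → 2 ≤ d → d ≤ n ∸ 1 →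
  ∀ k → g n d k ≡ (linear (a₂ n d) (b₂ n d) ⊗ g n (d ∸ 1) ⊖ scaled-t[t+1] (e₂ n d) ⊗ deriv (g n (d ∸ 1))) k
recurrence₂ n d _ _ _ zero = sym (cong₂ _-_ (*-zeroʳ (linear (a₂ n d) (b₂ n d) 0))
  (trans (cong (_* g′₀) (scaled-t[t+1]-zero (e₂ n d))) (*-zeroˡ g′₀)))
  where
  g′₀ : ℚ
  g′₀ = deriv (g n (d ∸ 1)) 0
recurrence₂ n d 3≤n 2≤d d≤n∸1 (suc r) = begin
  g n d (suc r)
    ≡⟨ coefficient-recurrence₂ r 3≤n 2≤d d<n (den₂-≢0 2≤d d<n) ⟩
  b₂ n d * g n (d ∸ 1) (suc r) + a₂ n d * g n (d ∸ 1) r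
    - (e₂ n d * (ℕ→ℚ (suc r) * g n (d ∸ 1) (suc r)) + e₂ n d * (ℕ→ℚ r * g n (d ∸ 1) r))
    ≡⟨ cong₂ _-_ (linear⊗-suc (a₂ n d) (b₂ n d) (g n (d ∸ 1)) r)
                 (scaled-t[t+1]⊗deriv-suc (e₂ n d) (g n (d ∸ 1)) r) ⟨
  (linear (a₂ n d) (b₂ n d) ⊗ g n (d ∸ 1) ⊖ scaled-t[t+1] (e₂ n d) ⊗ deriv (g n (d ∸ 1))) (suc r) ∎
  where
  d<n : d < n
  d<n = ≤n∸1⇒< (ℕ.≤-trans (s≤s z≤n) 3≤n) d≤n∸1

theorem2p2 : (n d : ℕ) → 3 ≤ n → 2 ≤ d →
    ((d ≤ suc (n / 2) →
       ∀ k → g n d k ≡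
         ((const ((c d (n ℕ.+ 1) * c d n * c d (n ℕ.+ 2))
                    ÷ (ℕ→ℚ (d ∸ 1) * ℕ→ℚ (n ∸ d) * c d (n ℕ.+ 2))) ⊗ T
           ⊕ const ((c d (n ℕ.+ 1) * (ℕ→ℚ (n ∸ d) * ℕ→ℚ (n ∸ d) + ℕ→ℚ (d ∸ 2) * ℕ→ℚ (d ∸ 2) + ℕ→ℚ (n ∸ 2)))
                    ÷ (ℕ→ℚ (d ∸ 1) * ℕ→ℚ (n ∸ d) * c d (n ℕ.+ 2)))) ⊗ g n (d ∸ 1)
         ⊖ const ((ℕ→ℚ (d ∸ 2) * ℕ→ℚ (n ℕ.+ 1 ∸ d) * c d n)
                    ÷ (ℕ→ℚ (d ∸ 1) * ℕ→ℚ (n ∸ d) * c d (n ℕ.+ 2))) ⊗ g n (d ∸ 2)) k)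
   × (d ≤ n ∸ 1 →
       ∀ k → g n d k ≡
         ((const ((c d n * ℕ→ℚ (n ℕ.+ 1 ∸ d))
                    ÷ (ℕ→ℚ (d ∸ 1) * ℕ→ℚ (n ∸ d))) ⊗ T
           ⊕ const ((ℕ→ℚ (n ∸ d) * ℕ→ℚ (n ∸ d) + ℕ→ℚ n - ℕ→ℚ (2 ℕ.* d) + ℕ→ℚ 1)
                    ÷ (ℕ→ℚ (d ∸ 1) * ℕ→ℚ (n ∸ d)))) ⊗ g n (d ∸ 1)
         ⊖ const ((c d n) ÷ (ℕ→ℚ (d ∸ 1) * ℕ→ℚ (n ∸ d))) ⊗ T ⊗ (T ⊕ const (ℕ→ℚ 1))
             ⊗ deriv (g n (d ∸ 1))) k))
theorem2p2 n d 3≤n 2≤d = recurrence₁ n d 3≤n 2≤d , recurrence₂ n d 3≤n 2≤d
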